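{- Let $D$ be a mixed graph such that every cycle of even length in $D$ contains an even number of digons and every cycle of odd length in $D$ contains an odd number of digons. Then $\sigma_\gamma(D)=\sigma_\omega(D)$, where $\gamma=e^{2\pi i/3}$ and $\omega=e^{\pi i/3}$.
   Context: A mixed graph $D$ is obtained from a finite simple undirected graph $\Gamma(D)$ by replacing some edges by arcs: between any two adjacent vertices $u,v$ there is exactly one of a digon $u\sim v$, an arc $u\to v$, or an arc $v\to u$. Cycles refer to $\Gamma(D)$. For $|\alpha|=1$, $H^\alpha(D)=[h_{uv}]$ has $h_{uv}=1$ if $u\sim v$, $\alpha$ if $u\to v$, $\bar\alpha$ if $v\to u$, $0$ otherwise, and $\sigma_\alpha(D)$ is its multiset of eigenvalues. -}

module Defs where

open import Data.Nat as ℕ using (ℕ; zero; suc)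
open import Data.Integer as ℤ using (ℤ; +_; -_)
open import Data.Product using (_×_; _,_; proj₁; proj₂)
open import Data.Fin as Fin using (Fin; zero; suc; inject₁; fromℕ; punchIn; toℕ)
open import Data.List as List using (List; []; _∷_; map; foldr; allFin)
open import Data.Nat.ListAction using (sum)
open import Data.Bool using (Bool; true; false; if_then_else_)
open import Relation.Nullary using (does)
open import Relation.Binary.PropositionalEquality using (_≡_; _≢_)

-- Mixed graphs on the vertex set Fin n.
-- adj u v = none   : u, v not adjacent
-- adj u v = digon  : u ∼ v
-- adj u v = out    : arc u → v
-- adj u v = inn    : arc v → u

data Link : Set where
  none digon out inn : Link

rev : Link → Link
rev none  = none
rev digon = digon
rev out   = inn
rev inn   = out

record MixedGraph (n : ℕ) : Set where
  field
    adj       : Fin n → Fin n → Link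
    loopless  : ∀ u → adj u u ≡ none
    adj-rev   : ∀ u v → adj v u ≡ rev (adj u v)
open MixedGraph public

-- A cycle of the underlying graph Γ(D), of length k = suc m ≥ 3:
-- distinct vertices v 0, …, v m, consecutive ones adjacent, v m adjacent to v 0.
record Cycle {n : ℕ} (D : MixedGraph n) : Set where
  field
    m         : ℕ
    long      : 2 ℕ.≤ m
    vert      : Fin (suc m) → Fin n
    injective : ∀ i j → vert i ≡ vert j → i ≡ j
    step-adj  : ∀ (i : Fin m) → adj D (vert (inject₁ i)) (vert (suc i)) ≢ none
    close-adj : adj D (vert (fromℕ m)) (vert zero) ≢ none
open Cycle public

cycleLength : ∀ {n} {D : MixedGraph n} → Cycle D → ℕ
cycleLength C = suc (m C)

isDigon : Link → ℕ
isDigon digon = 1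
isDigon _     = 0

digonCount : ∀ {n} {D : MixedGraph n} → Cycle D → ℕ
digonCount {D = D} C =
  sum (map (λ i → isDigon (adj D (vert C (inject₁ i)) (vert C (suc i)))) (allFin (m C)))
  ℕ.+ isDigon (adj D (vert C (fromℕ (m C))) (vert C zero))

-- Eisenstein integers ℤ[ω], ω = e^{πi/3}, ω² = ω - 1.
-- (a , b) represents a + b ω.  This is a subring of ℂ containing
-- ω, γ = e^{2πi/3} = ω - 1, and closed under complex conjugation.

Eis : Set
Eis = ℤ × ℤ

0E 1E ωE γE : Eis
0E = (+ 0 , + 0)
1E = (+ 1 , + 0)
ωE = (+ 0 , + 1)
γE = (- (+ 1) , + 1)

_+E_ : Eis → Eis → Eis
(a , b) +E (c , d) = (a ℤ.+ c , b ℤ.+ d)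

-E_ : Eis → Eis
-E (a , b) = (- a , - b)

-- (a + bω)(c + dω) = (ac - bd) + (ad + bc + bd) ω
_*E_ : Eis → Eis → Eis
(a , b) *E (c , d) = (a ℤ.* c ℤ.- b ℤ.* d , a ℤ.* d ℤ.+ b ℤ.* c ℤ.+ b ℤ.* d)

-- complex conjugation: conj ω = 1 - ω
conjE : Eis → Eis
conjE (a , b) = (a ℤ.+ b , - b)

hEntry : Eis → Link → Eis
hEntry α none  = 0E
hEntry α digon = 1E
hEntry α out   = α
hEntry α inn   = conjE α

Hα : ∀ {n} → Eis → MixedGraph n → Fin n → Fin n → Eis
Hα α D u v = hEntry α (adj D u v)

-- Polynomials over ℤ[ω] as coefficient lists (constant term first).

Poly : Set
Poly = List Eis

coeff : Poly → ℕ → Eis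
coeff []       _       = 0E
coeff (c ∷ p)  zero    = c
coeff (c ∷ p)  (suc k) = coeff p k

_≈P_ : Poly → Poly → Set
p ≈P q = ∀ k → coeff p k ≡ coeff q k

_+P_ : Poly → Poly → Poly
[]      +P q       = q
p       +P []      = p
(a ∷ p) +P (b ∷ q) = (a +E b) ∷ (p +P q)

scaleP : Eis → Poly → Poly
scaleP c = map (c *E_)

_*P_ : Poly → Poly → Poly
[]      *P q = []
(a ∷ p) *P q = scaleP a q +P (0E ∷ (p *P q))

constP : Eis → Poly
constP c = c ∷ []

xP : Poly
xP = 0E ∷ 1E ∷ []

signP : ℕ → Poly
signP zero    = constP 1E
signP (suc k) = scaleP (-E 1E) (signP k)

sumP : List Poly → Poly
sumP = foldr _+P_ []

det : ∀ n → (Fin n → Fin n → Poly) → Poly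
det zero    M = constP 1E
det (suc n) M =
  sumP (map (λ j → signP (toℕ j) *P (M zero j *P det n (λ r c → M (suc r) (punchIn j c))))
            (allFin (suc n)))

charPoly : ∀ n → (Fin n → Fin n → Eis) → Poly
charPoly n A = det n (λ i j →
  (if does (i Fin.≟ j) then xP else []) +P constP (-E (A i j)))

-- σ_α(D) = σ_β(D) : the spectra (multisets of eigenvalues) coincide,
-- i.e. the characteristic polynomials coincide.
SameSpectrum : ∀ {n} → MixedGraph n → Eis → Eis → Set
SameSpectrum {n} D α β = charPoly n (Hα α D) ≈P charPoly n (Hα β D)

-- The hypothesis says that on every cycle the length and the number of digons have the same
-- parity, i.e. every cycle carries an even number of arcs.  Then so does every closed walk (shortcut
-- it at a repeated vertex), and propagating parities along the components yields a switching
-- function s : V → ℤ/2 with s u + s v = 1 exactly across arcs.  Conjugating by the diagonal matrix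
-- S = diag((-1)^(s v)) negates exactly the arc entries, so S H^ω S = H^(-ω).  Since H^α is
-- Hermitian, the transpose of H^γ is H^(conj γ), and conj γ = -ω.  Transposition and conjugation
-- by S both preserve det (x I - H), so H^γ and H^ω have the same characteristic polynomial.

module Submission where

open import Defs hiding (det)
open import Level using (0ℓ)
open import Data.Nat as ℕ using (ℕ; zero; suc; _≤_; z≤n; s≤s; parity)
open import Data.Nat.Divisibility using (_∣_; divides; _∣0; ∣-refl; ∣m∣n⇒∣m+n)
import Data.Nat.ListAction as ListAction
import Data.Integer as ℤ
import Data.Integer.Properties as ℤ
open import Data.Integer.Tactic.RingSolver using (solve-∀)
open import Data.Parity.Base using (Parity; 0ℙ; 1ℙ) renaming (_+_ to _⊕_)
import Data.Parity.Properties as ℙ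
open import Data.Fin using (Fin; zero; suc; _≟_; punchIn; toℕ; fromℕ; inject₁)
open import Data.Bool using (if_then_else_)
open import Data.Product using (Σ; Σ-syntax; ∃₂; _×_; _,_; proj₁; proj₂)
open import Data.Sum using (_⊎_; inj₁; inj₂)
open import Data.Unit using (⊤; tt)
open import Data.List as List using (List; []; _∷_; allFin; tabulate; cartesianProduct)
open import Data.List.Properties using (map-tabulate; map-cong)
open import Data.List.Relation.Unary.All as All using (All; []; _∷_)
open import Data.List.Membership.Propositional.Properties using (∈-cartesianProduct⁺; ∈-allFin)
open import Function using (id)
open import Relation.Nullary using (¬_; Dec; does; yes; no; ¬?; contradiction)
open import Relation.Binary.Definitions using (Decidable)
open import Relation.Binary.Structures using (IsEquivalence)
open import Relation.Binary.Bundles using (Setoid)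
open import Relation.Binary.PropositionalEquality
  using (_≡_; _≢_; refl; sym; trans; cong; cong₂; subst; subst₂; isEquivalence; module ≡-Reasoning)
open import Algebra.Bundles using (CommutativeRing)
open import Algebra.Definitions (_≡_ {A = Eis}) using (Associative; Commutative; LeftIdentity; LeftInverse; _DistributesOverʳ_)
import Algebra.Consequences.Propositional {A = Eis} as EisConsequences
import Algebra.Consequences.Setoid as SetoidConsequences
import Algebra.Properties.Ring as RingProperties
import Algebra.Properties.CommutativeMonoid.Sum as MonoidSum
import Algebra.Solver.CommutativeMonoid as CommutativeMonoidSolver
open import Algebra.Properties.CommutativeSemigroup ℙ.+-commutativeSemigroup using (interchange)

-- The ring ℤ[ω]

+E-assoc : Associative _+E_
+E-assoc (a , b) (c , d) (e , f) = cong₂ _,_ (ℤ.+-assoc a c e) (ℤ.+-assoc b d f)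

+E-comm : Commutative _+E_
+E-comm (a , b) (c , d) = cong₂ _,_ (ℤ.+-comm a c) (ℤ.+-comm b d)

+E-identityˡ : LeftIdentity 0E _+E_
+E-identityˡ (a , b) = cong₂ _,_ (ℤ.+-identityˡ a) (ℤ.+-identityˡ b)

-E-inverseˡ : LeftInverse 0E -E_ _+E_
-E-inverseˡ (a , b) = cong₂ _,_ (ℤ.+-inverseˡ a) (ℤ.+-inverseˡ b)

*E-assoc : Associative _*E_
*E-assoc (a , b) (c , d) (e , f) = cong₂ _,_ (re a b c d e f) (im a b c d e f)
  where
  re : ∀ a b c d e f →
       (a ℤ.* c ℤ.- b ℤ.* d) ℤ.* e ℤ.- (a ℤ.* d ℤ.+ b ℤ.* c ℤ.+ b ℤ.* d) ℤ.* f
       ≡ a ℤ.* (c ℤ.* e ℤ.- d ℤ.* f) ℤ.- b ℤ.* (c ℤ.* f ℤ.+ d ℤ.* e ℤ.+ d ℤ.* f)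
  re = solve-∀
  im : ∀ a b c d e f →
       (a ℤ.* c ℤ.- b ℤ.* d) ℤ.* f ℤ.+ (a ℤ.* d ℤ.+ b ℤ.* c ℤ.+ b ℤ.* d) ℤ.* e
         ℤ.+ (a ℤ.* d ℤ.+ b ℤ.* c ℤ.+ b ℤ.* d) ℤ.* f
       ≡ a ℤ.* (c ℤ.* f ℤ.+ d ℤ.* e ℤ.+ d ℤ.* f) ℤ.+ b ℤ.* (c ℤ.* e ℤ.- d ℤ.* f)
         ℤ.+ b ℤ.* (c ℤ.* f ℤ.+ d ℤ.* e ℤ.+ d ℤ.* f)
  im = solve-∀

*E-comm : Commutative _*E_
*E-comm (a , b) (c , d) = cong₂ _,_ (re a b c d) (im a b c d)
  where
  re : ∀ a b c d → a ℤ.* c ℤ.- b ℤ.* d ≡ c ℤ.* a ℤ.- d ℤ.* b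
  re = solve-∀
  im : ∀ a b c d → a ℤ.* d ℤ.+ b ℤ.* c ℤ.+ b ℤ.* d ≡ c ℤ.* b ℤ.+ d ℤ.* a ℤ.+ d ℤ.* b
  im = solve-∀

*E-identityˡ : LeftIdentity 1E _*E_
*E-identityˡ (a , b) = cong₂ _,_ (re a b) (im a b)
  where
  re : ∀ a b → ℤ.1ℤ ℤ.* a ℤ.- ℤ.0ℤ ℤ.* b ≡ a
  re = solve-∀
  im : ∀ a b → ℤ.1ℤ ℤ.* b ℤ.+ ℤ.0ℤ ℤ.* a ℤ.+ ℤ.0ℤ ℤ.* b ≡ b
  im = solve-∀

*E-distribʳ : _*E_ DistributesOverʳ _+E_
*E-distribʳ (a , b) (c , d) (e , f) = cong₂ _,_ (re a b c d e f) (im a b c d e f)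
  where
  re : ∀ a b c d e f → (c ℤ.+ e) ℤ.* a ℤ.- (d ℤ.+ f) ℤ.* b ≡ (c ℤ.* a ℤ.- d ℤ.* b) ℤ.+ (e ℤ.* a ℤ.- f ℤ.* b)
  re = solve-∀
  im : ∀ a b c d e f →
       (c ℤ.+ e) ℤ.* b ℤ.+ (d ℤ.+ f) ℤ.* a ℤ.+ (d ℤ.+ f) ℤ.* b
       ≡ (c ℤ.* b ℤ.+ d ℤ.* a ℤ.+ d ℤ.* b) ℤ.+ (e ℤ.* b ℤ.+ f ℤ.* a ℤ.+ f ℤ.* b)
  im = solve-∀

Eis-commutativeRing : CommutativeRing 0ℓ 0ℓ
Eis-commutativeRing = record
  { Carrier = Eis ; _≈_ = _≡_ ; _+_ = _+E_ ; _*_ = _*E_ ; -_ = -E_ ; 0# = 0E ; 1# = 1E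
  ; isCommutativeRing = record
    { isRing = record
      { +-isAbelianGroup = record
        { isGroup = record
          { isMonoid = record
            { isSemigroup = record
              { isMagma = record { isEquivalence = isEquivalence ; ∙-cong = cong₂ _+E_ }
              ; assoc = +E-assoc }
            ; identity = comm∧idˡ⇒id +E-comm +E-identityˡ }
          ; inverse = comm∧invˡ⇒inv +E-comm -E-inverseˡ
          ; ⁻¹-cong = cong -E_ }
        ; comm = +E-comm }
      ; *-cong = cong₂ _*E_
      ; *-assoc = *E-assoc
      ; *-identity = comm∧idˡ⇒id *E-comm *E-identityˡ
      ; distrib = comm∧distrʳ⇒distrˡ *E-comm *E-distribʳ , *E-distribʳ }
    ; *-comm = *E-comm } }
  where open EisConsequences

conjE-involutive : ∀ x → conjE (conjE x) ≡ x
conjE-involutive (a , b) = cong₂ _,_ (re a b) (ℤ.neg-involutive b)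
  where
  re : ∀ a b → a ℤ.+ b ℤ.+ ℤ.- b ≡ a
  re = solve-∀

conjE-neg : ∀ x → conjE (-E x) ≡ -E conjE x
conjE-neg (a , b) = cong₂ _,_ (sym (ℤ.neg-distrib-+ a b)) refl

private module E = CommutativeRing Eis-commutativeRing

open RingProperties E.ring using (-1*x≈-x)

-- The polynomial ring ℤ[ω][x]

infix 4 _≋_

-- _≈P_ unfolds to a function type, from which Agda cannot infer the two polynomials.
record _≋_ (p q : Poly) : Set where
  constructor coeffwise
  field coeff-≡ : p ≈P q
open _≋_

≋-isEquivalence : IsEquivalence _≋_
≋-isEquivalence = record
  { refl = coeffwise λ _ → refl
  ; sym = λ p≋q → coeffwise λ k → sym (coeff-≡ p≋q k)
  ; trans = λ p≋q q≋r → coeffwise λ k → trans (coeff-≡ p≋q k) (coeff-≡ q≋r k) }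

open IsEquivalence ≋-isEquivalence
  renaming (refl to ≋-refl; sym to ≋-sym; trans to ≋-trans; reflexive to ≋-reflexive)

≋-setoid : Setoid 0ℓ 0ℓ
≋-setoid = record { isEquivalence = ≋-isEquivalence }

coeff-+P : ∀ p q k → coeff (p +P q) k ≡ coeff p k +E coeff q k
coeff-+P []      q       k       = sym (E.+-identityˡ _)
coeff-+P (a ∷ p) []      k       = sym (E.+-identityʳ _)
coeff-+P (a ∷ p) (b ∷ q) zero    = refl
coeff-+P (a ∷ p) (b ∷ q) (suc k) = coeff-+P p q k

coeff-scaleP : ∀ c p k → coeff (scaleP c p) k ≡ c *E coeff p k
coeff-scaleP c []      k       = sym (E.zeroʳ c)
coeff-scaleP c (a ∷ p) zero    = refl
coeff-scaleP c (a ∷ p) (suc k) = coeff-scaleP c p k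

∷-cong : ∀ {a b p q} → a ≡ b → p ≋ q → a ∷ p ≋ b ∷ q
∷-cong a≡b p≋q = coeffwise λ { zero → a≡b ; (suc k) → coeff-≡ p≋q k }

∷≋∷⇒ : ∀ {a b p q} → a ∷ p ≋ b ∷ q → a ≡ b × p ≋ q
∷≋∷⇒ e = coeff-≡ e zero , coeffwise λ k → coeff-≡ e (suc k)

∷≋[]⇒ : ∀ {a p} → a ∷ p ≋ [] → a ≡ 0E × p ≋ []
∷≋[]⇒ e = coeff-≡ e zero , coeffwise λ k → coeff-≡ e (suc k)

0∷[]≋[] : 0E ∷ [] ≋ []
0∷[]≋[] = coeffwise λ { zero → refl ; (suc k) → refl }

+P-cong : ∀ {p p′ q q′} → p ≋ p′ → q ≋ q′ → p +P q ≋ p′ +P q′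
+P-cong {p} {p′} {q} {q′} p≋p′ q≋q′ = coeffwise λ k → begin
  coeff (p +P q) k          ≡⟨ coeff-+P p q k ⟩
  coeff p k +E coeff q k    ≡⟨ cong₂ _+E_ (coeff-≡ p≋p′ k) (coeff-≡ q≋q′ k) ⟩
  coeff p′ k +E coeff q′ k  ≡⟨ coeff-+P p′ q′ k ⟨
  coeff (p′ +P q′) k        ∎
  where open ≡-Reasoning

+P-congˡ : ∀ p {q q′} → q ≋ q′ → p +P q ≋ p +P q′
+P-congˡ p = +P-cong {p} ≋-refl

+P-assoc : ∀ p q r → (p +P q) +P r ≋ p +P (q +P r)
+P-assoc p q r = coeffwise λ k → begin
  coeff ((p +P q) +P r) k                  ≡⟨ coeff-+P (p +P q) r k ⟩
  coeff (p +P q) k +E coeff r k            ≡⟨ cong (_+E coeff r k) (coeff-+P p q k) ⟩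
  (coeff p k +E coeff q k) +E coeff r k    ≡⟨ E.+-assoc (coeff p k) (coeff q k) (coeff r k) ⟩
  coeff p k +E (coeff q k +E coeff r k)    ≡⟨ cong (coeff p k +E_) (coeff-+P q r k) ⟨
  coeff p k +E coeff (q +P r) k            ≡⟨ coeff-+P p (q +P r) k ⟨
  coeff (p +P (q +P r)) k                  ∎
  where open ≡-Reasoning

+P-comm : ∀ p q → p +P q ≋ q +P p
+P-comm p q = coeffwise λ k → begin
  coeff (p +P q) k        ≡⟨ coeff-+P p q k ⟩
  coeff p k +E coeff q k  ≡⟨ E.+-comm (coeff p k) (coeff q k) ⟩
  coeff q k +E coeff p k  ≡⟨ coeff-+P q p k ⟨
  coeff (q +P p) k        ∎
  where open ≡-Reasoning

negP : Poly → Poly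
negP = scaleP (-E 1E)

negP-inverseʳ : ∀ p → p +P negP p ≋ []
negP-inverseʳ p = coeffwise λ k → begin
  coeff (p +P negP p) k                  ≡⟨ coeff-+P p (negP p) k ⟩
  coeff p k +E coeff (negP p) k          ≡⟨ cong (coeff p k +E_) (coeff-scaleP (-E 1E) p k) ⟩
  coeff p k +E ((-E 1E) *E coeff p k)    ≡⟨ cong (coeff p k +E_) (-1*x≈-x (coeff p k)) ⟩
  coeff p k +E (-E coeff p k)            ≡⟨ E.-‿inverseʳ (coeff p k) ⟩
  0E                                     ∎
  where open ≡-Reasoning

+P-identityʳ : ∀ p → p +P [] ≋ p
+P-identityʳ p = +P-comm p []

+P-middleFour : ∀ p q r s → (p +P q) +P (r +P s) ≋ (p +P r) +P (q +P s)
+P-middleFour = comm∧assoc⇒middleFour +P-cong +P-comm +P-assoc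
  where open SetoidConsequences ≋-setoid

scaleP-cong : ∀ c {p q} → p ≋ q → scaleP c p ≋ scaleP c q
scaleP-cong c {p} {q} p≋q = coeffwise λ k → begin
  coeff (scaleP c p) k  ≡⟨ coeff-scaleP c p k ⟩
  c *E coeff p k        ≡⟨ cong (c *E_) (coeff-≡ p≋q k) ⟩
  c *E coeff q k        ≡⟨ coeff-scaleP c q k ⟨
  coeff (scaleP c q) k  ∎
  where open ≡-Reasoning

scaleP-+P : ∀ c p q → scaleP c (p +P q) ≋ scaleP c p +P scaleP c q
scaleP-+P c []      q       = ≋-refl
scaleP-+P c (a ∷ p) []      = ≋-refl
scaleP-+P c (a ∷ p) (b ∷ q) = ∷-cong (E.distribˡ c a b) (scaleP-+P c p q)

scaleP-+E : ∀ a b p → scaleP (a +E b) p ≋ scaleP a p +P scaleP b p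
scaleP-+E a b []      = ≋-refl
scaleP-+E a b (c ∷ p) = ∷-cong (E.distribʳ c a b) (scaleP-+E a b p)

scaleP-*E : ∀ a b p → scaleP a (scaleP b p) ≋ scaleP (a *E b) p
scaleP-*E a b []      = ≋-refl
scaleP-*E a b (c ∷ p) = ∷-cong (sym (E.*-assoc a b c)) (scaleP-*E a b p)

scaleP-0E : ∀ p → scaleP 0E p ≋ []
scaleP-0E []      = ≋-refl
scaleP-0E (a ∷ p) = ≋-trans (∷-cong (E.zeroˡ a) (scaleP-0E p)) 0∷[]≋[]

scaleP-1E : ∀ p → scaleP 1E p ≋ p
scaleP-1E []      = ≋-refl
scaleP-1E (a ∷ p) = ∷-cong (E.*-identityˡ a) (scaleP-1E p)

scaleP-0∷ : ∀ a p → scaleP a (0E ∷ p) ≋ 0E ∷ scaleP a p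
scaleP-0∷ a p = ∷-cong (E.zeroʳ a) ≋-refl

*P-zeroˡ : ∀ {p} q → p ≋ [] → p *P q ≋ []
*P-zeroˡ {[]}    q _   = ≋-refl
*P-zeroˡ {a ∷ p} q a∷p≋[] with ∷≋[]⇒ a∷p≋[]
... | refl , p≋[] = begin
  scaleP 0E q +P (0E ∷ p *P q)  ≈⟨ +P-cong (scaleP-0E q) (∷-cong refl (*P-zeroˡ q p≋[])) ⟩
  0E ∷ []                       ≈⟨ 0∷[]≋[] ⟩
  []                            ∎
  where open import Relation.Binary.Reasoning.Setoid ≋-setoid

*P-congˡ : ∀ {p p′} q → p ≋ p′ → p *P q ≋ p′ *P q
*P-congˡ {[]}    {[]}      q _ = ≋-refl
*P-congˡ {[]}    {a′ ∷ p′} q e = ≋-sym (*P-zeroˡ q (≋-sym e))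
*P-congˡ {a ∷ p} {[]}      q e = *P-zeroˡ q e
*P-congˡ {a ∷ p} {a′ ∷ p′} q e with ∷≋∷⇒ e
... | refl , p≋p′ = +P-congˡ (scaleP a q) (∷-cong refl (*P-congˡ q p≋p′))

0∷-*P : ∀ p q → (0E ∷ p) *P q ≋ 0E ∷ (p *P q)
0∷-*P p q = +P-cong (scaleP-0E q) ≋-refl

*P-distribʳ : ∀ r p q → (p +P q) *P r ≋ (p *P r) +P (q *P r)
*P-distribʳ r []      q       = ≋-refl
*P-distribʳ r (a ∷ p) []      = ≋-sym (+P-identityʳ _)
*P-distribʳ r (a ∷ p) (b ∷ q) = begin
  scaleP (a +E b) r +P (0E ∷ (p +P q) *P r)
    ≈⟨ +P-cong (scaleP-+E a b r) (∷-cong refl (*P-distribʳ r p q)) ⟩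
  (scaleP a r +P scaleP b r) +P ((0E ∷ p *P r) +P (0E ∷ q *P r))
    ≈⟨ +P-middleFour (scaleP a r) (scaleP b r) (0E ∷ p *P r) (0E ∷ q *P r) ⟩
  (scaleP a r +P (0E ∷ p *P r)) +P (scaleP b r +P (0E ∷ q *P r))
    ∎
  where open import Relation.Binary.Reasoning.Setoid ≋-setoid

scaleP-*P : ∀ a p q → scaleP a p *P q ≋ scaleP a (p *P q)
scaleP-*P a []      q = ≋-refl
scaleP-*P a (b ∷ p) q = begin
  scaleP (a *E b) q +P (0E ∷ scaleP a p *P q)
    ≈⟨ +P-cong (≋-sym (scaleP-*E a b q)) (∷-cong refl (scaleP-*P a p q)) ⟩
  scaleP a (scaleP b q) +P (0E ∷ scaleP a (p *P q))
    ≈⟨ +P-congˡ (scaleP a (scaleP b q)) (≋-sym (scaleP-0∷ a (p *P q))) ⟩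
  scaleP a (scaleP b q) +P scaleP a (0E ∷ p *P q)
    ≈⟨ scaleP-+P a (scaleP b q) (0E ∷ p *P q) ⟨
  scaleP a (scaleP b q +P (0E ∷ p *P q))
    ∎
  where open import Relation.Binary.Reasoning.Setoid ≋-setoid

*P-zeroʳ : ∀ p → p *P [] ≋ []
*P-zeroʳ []      = ≋-refl
*P-zeroʳ (a ∷ p) = ≋-trans (∷-cong refl (*P-zeroʳ p)) 0∷[]≋[]

*P-∷ʳ : ∀ p b q → p *P (b ∷ q) ≋ scaleP b p +P (0E ∷ p *P q)
*P-∷ʳ []      b q = ≋-sym 0∷[]≋[]
*P-∷ʳ (a ∷ p) b q = ∷-cong (cong (_+E 0E) (E.*-comm a b)) (begin
  scaleP a q +P (p *P (b ∷ q))
    ≈⟨ +P-congˡ (scaleP a q) (*P-∷ʳ p b q) ⟩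
  scaleP a q +P (scaleP b p +P (0E ∷ p *P q))
    ≈⟨ +P-assoc (scaleP a q) (scaleP b p) (0E ∷ p *P q) ⟨
  (scaleP a q +P scaleP b p) +P (0E ∷ p *P q)
    ≈⟨ +P-cong (+P-comm (scaleP a q) (scaleP b p)) ≋-refl ⟩
  (scaleP b p +P scaleP a q) +P (0E ∷ p *P q)
    ≈⟨ +P-assoc (scaleP b p) (scaleP a q) (0E ∷ p *P q) ⟩
  scaleP b p +P (scaleP a q +P (0E ∷ p *P q))
    ∎)
  where open import Relation.Binary.Reasoning.Setoid ≋-setoid

*P-comm : ∀ p q → p *P q ≋ q *P p
*P-comm []      q = ≋-sym (*P-zeroʳ q)
*P-comm (a ∷ p) q = ≋-trans (+P-congˡ (scaleP a q) (∷-cong refl (*P-comm p q))) (≋-sym (*P-∷ʳ q a p))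

*P-congʳ : ∀ p {q q′} → q ≋ q′ → p *P q ≋ p *P q′
*P-congʳ p {q} {q′} q≋q′ = ≋-trans (*P-comm p q) (≋-trans (*P-congˡ p q≋q′) (*P-comm q′ p))

*P-assoc : ∀ p q r → (p *P q) *P r ≋ p *P (q *P r)
*P-assoc []      q r = ≋-refl
*P-assoc (a ∷ p) q r = begin
  (scaleP a q +P (0E ∷ p *P q)) *P r
    ≈⟨ *P-distribʳ r (scaleP a q) (0E ∷ p *P q) ⟩
  (scaleP a q *P r) +P ((0E ∷ p *P q) *P r)
    ≈⟨ +P-cong (scaleP-*P a q r) (0∷-*P (p *P q) r) ⟩
  scaleP a (q *P r) +P (0E ∷ (p *P q) *P r)
    ≈⟨ +P-congˡ (scaleP a (q *P r)) (∷-cong refl (*P-assoc p q r)) ⟩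
  scaleP a (q *P r) +P (0E ∷ p *P (q *P r))
    ∎
  where open import Relation.Binary.Reasoning.Setoid ≋-setoid

*P-identityˡ : ∀ p → constP 1E *P p ≋ p
*P-identityˡ p = ≋-trans (+P-cong (scaleP-1E p) 0∷[]≋[]) (+P-identityʳ p)

Poly-commutativeRing : CommutativeRing 0ℓ 0ℓ
Poly-commutativeRing = record
  { Carrier = Poly ; _≈_ = _≋_ ; _+_ = _+P_ ; _*_ = _*P_ ; -_ = negP ; 0# = [] ; 1# = constP 1E
  ; isCommutativeRing = record
    { isRing = record
      { +-isAbelianGroup = record
        { isGroup = record
          { isMonoid = record
            { isSemigroup = record
              { isMagma = record { isEquivalence = ≋-isEquivalence ; ∙-cong = +P-cong }
              ; assoc = +P-assoc }
            ; identity = (λ _ → ≋-refl) , +P-identityʳ }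
          ; inverse = comm∧invʳ⇒inv +P-comm negP-inverseʳ
          ; ⁻¹-cong = scaleP-cong (-E 1E) }
        ; comm = +P-comm }
      ; *-cong = λ {p} {p′} {q} p≋p′ q≋q′ → ≋-trans (*P-congˡ q p≋p′) (*P-congʳ p′ q≋q′)
      ; *-assoc = *P-assoc
      ; *-identity = comm∧idˡ⇒id *P-comm *P-identityˡ
      ; distrib = comm∧distrʳ⇒distr +P-cong *P-comm *P-distribʳ }
    ; *-comm = *P-comm } }
  where open SetoidConsequences ≋-setoid

-- Determinants over a commutative ring

module Determinant {c ℓ} (R : CommutativeRing c ℓ) where

  open CommutativeRing R hiding (zero; refl; sym; trans; reflexive)
  open CommutativeRing R using ()
    renaming (refl to ≈-refl; sym to ≈-sym; trans to ≈-trans; reflexive to ≈-reflexive)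
  open import Algebra.Properties.Semiring.Sum semiring using (sum; sum-cong-≋; ∑-comm; *-distribˡ-sum)
  open import Relation.Binary.Reasoning.Setoid setoid
  open RingProperties ring using (-‿distribˡ-*; x[y-z]≈xy-xz)
  private module Product = MonoidSum *-commutativeMonoid
  open CommutativeMonoidSolver *-commutativeMonoid using (solve; _⊜_) renaming (_⊕_ to _⊗_)

  -- Opaque, so that unification does not unfold sums over Fin (suc n).
  opaque
    ∑-syntax : ∀ n → (Fin n → Carrier) → Carrier
    ∑-syntax _ = sum

  syntax ∑-syntax n (λ i → x) = ∑[ i < n ] x

  opaque
    unfolding ∑-syntax

    ∑-cong : ∀ {n} {f g : Fin n → Carrier} → (∀ i → f i ≈ g i) → ∑[ i < n ] f i ≈ ∑[ i < n ] g i
    ∑-cong = sum-cong-≋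

    ∑-suc : ∀ {n} (f : Fin (suc n) → Carrier) → ∑[ i < suc n ] f i ≈ f zero + ∑[ i < n ] f (suc i)
    ∑-suc f = ≈-refl

    ∑-swap : ∀ {m n} (f : Fin m → Fin n → Carrier) →
             ∑[ i < m ] ∑[ j < n ] f i j ≈ ∑[ j < n ] ∑[ i < m ] f i j
    ∑-swap = ∑-comm

    *-distribˡ-∑ : ∀ {n} x (f : Fin n → Carrier) → x * ∑[ i < n ] f i ≈ ∑[ i < n ] (x * f i)
    *-distribˡ-∑ = *-distribˡ-sum

    foldr-map-allFin : ∀ {n} (f : Fin n → Carrier) → List.foldr _+_ 0# (List.map f (List.allFin n)) ≡ ∑[ i < n ] f i
    foldr-map-allFin f = trans (cong (List.foldr _+_ 0#) (map-tabulate id f)) (foldr-tabulate f)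
      where
      foldr-tabulate : ∀ {n} (f : Fin n → Carrier) → List.foldr _+_ 0# (List.tabulate f) ≡ sum f
      foldr-tabulate {zero}  f = refl
      foldr-tabulate {suc n} f = cong (f zero +_) (foldr-tabulate (λ i → f (suc i)))

  Matrix : ℕ → Set c
  Matrix n = Fin n → Fin n → Carrier

  ∏ : ∀ {n} → (Fin n → Carrier) → Carrier
  ∏ = Product.sum

  sign : ℕ → Carrier
  sign zero    = 1#
  sign (suc k) = - sign k

  minor columnMinor : ∀ {n} → Matrix (suc n) → Fin (suc n) → Matrix n
  minor       M j r c = M (suc r) (punchIn j c)
  columnMinor M i r c = M (punchIn i r) (suc c)

  det : ∀ n → Matrix n → Carrier
  det zero    M = 1#
  det (suc n) M = ∑[ j < suc n ] (sign (toℕ j) * (M zero j * det n (minor M j)))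

  det-cong : ∀ n {M N : Matrix n} → (∀ i j → M i j ≈ N i j) → det n M ≈ det n N
  det-cong zero    M≈N = ≈-refl
  det-cong (suc n) M≈N = ∑-cong λ j →
    *-congˡ (*-cong (M≈N zero j) (det-cong n λ r c → M≈N (suc r) (punchIn j c)))

  det-scale : ∀ n (a b : Fin n → Carrier) (M : Matrix n) →
              det n (λ i j → a i * (b j * M i j)) ≈ (∏ a * ∏ b) * det n M
  det-scale zero    a b M = ≈-sym (≈-trans (*-identityʳ (1# * 1#)) (*-identityʳ 1#))
  det-scale (suc n) a b M = begin
    ∑[ j < suc n ] (sign (toℕ j) * ((a zero * (b j * M zero j)) *
                                    det n (λ r c → a (suc r) * (b (punchIn j c) * minor M j r c))))
      ≈⟨ ∑-cong (λ j → *-congˡ (*-congˡ (det-scale n (λ r → a (suc r)) (λ c → b (punchIn j c)) (minor M j)))) ⟩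
    ∑[ j < suc n ] (sign (toℕ j) * ((a zero * (b j * M zero j)) *
                                    ((∏ (λ r → a (suc r)) * ∏ (λ c → b (punchIn j c))) * det n (minor M j))))
      ≈⟨ ∑-cong (λ j → rearrange (sign (toℕ j)) (a zero) (b j) (M zero j) _ _ (det n (minor M j))) ⟩
    ∑[ j < suc n ] ((∏ a * (b j * ∏ (λ c → b (punchIn j c)))) * (sign (toℕ j) * (M zero j * det n (minor M j))))
      ≈⟨ ∑-cong (λ j → *-congʳ (*-congˡ (≈-sym (Product.sum-remove b)))) ⟩
    ∑[ j < suc n ] ((∏ a * ∏ b) * (sign (toℕ j) * (M zero j * det n (minor M j))))
      ≈⟨ *-distribˡ-∑ (∏ a * ∏ b) _ ⟨
    (∏ a * ∏ b) * det (suc n) M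
      ∎
    where
    rearrange : ∀ s a₀ bⱼ m pa pb d → s * ((a₀ * (bⱼ * m)) * ((pa * pb) * d)) ≈ ((a₀ * pa) * (bⱼ * pb)) * (s * (m * d))
    rearrange = solve 7 (λ s a₀ bⱼ m pa pb d →
      s ⊗ ((a₀ ⊗ (bⱼ ⊗ m)) ⊗ ((pa ⊗ pb) ⊗ d)) ⊜ ((a₀ ⊗ pa) ⊗ (bⱼ ⊗ pb)) ⊗ (s ⊗ (m ⊗ d))) ≈-refl

  det-expand-column : ∀ n (M : Matrix (suc n)) →
    det (suc n) M ≈ ∑[ i < suc n ] (sign (toℕ i) * (M i zero * det n (columnMinor M i)))
  det-expand-column zero    M = ∑-cong λ { zero → ≈-refl }
  det-expand-column (suc n) M = ≈-trans (∑-suc _) (≈-trans (+-congˡ (begin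
    ∑[ j < suc n ] (sign (suc (toℕ j)) * (M zero (suc j) * det (suc n) (minor M (suc j))))
      ≈⟨ ∑-cong (λ j → *-congˡ (*-congˡ (det-expand-column n (minor M (suc j))))) ⟩
    ∑[ j < suc n ] (sign (suc (toℕ j)) * (M zero (suc j) * ∑[ i < suc n ] (sign (toℕ i) * (M (suc i) zero * E i j))))
      ≈⟨ ∑-cong (λ j → distribute (sign (suc (toℕ j))) (M zero (suc j)) _) ⟩
    ∑[ j < suc n ] ∑[ i < suc n ] (sign (suc (toℕ j)) * (M zero (suc j) * (sign (toℕ i) * (M (suc i) zero * E i j))))
      ≈⟨ ∑-swap _ ⟩
    ∑[ i < suc n ] ∑[ j < suc n ] (sign (suc (toℕ j)) * (M zero (suc j) * (sign (toℕ i) * (M (suc i) zero * E i j))))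
      ≈⟨ ∑-cong (λ i → ∑-cong (λ j → swap (sign (toℕ i)) (sign (toℕ j)) _ _ (E i j))) ⟩
    ∑[ i < suc n ] ∑[ j < suc n ] (sign (suc (toℕ i)) * (M (suc i) zero * (sign (toℕ j) * (M zero (suc j) * E i j))))
      ≈⟨ ∑-cong (λ i → distribute (sign (suc (toℕ i))) (M (suc i) zero) _) ⟨
    ∑[ i < suc n ] (sign (suc (toℕ i)) * (M (suc i) zero * det (suc n) (columnMinor M (suc i))))
      ∎)) (≈-sym (∑-suc _)))
    where
    E : Fin (suc n) → Fin (suc n) → Carrier
    E i j = det n (λ r c → M (suc (punchIn i r)) (suc (punchIn j c)))
    distribute : ∀ {m} x y (f : Fin m → Carrier) → x * (y * ∑[ k < m ] f k) ≈ ∑[ k < m ] (x * (y * f k))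
    distribute x y f = ≈-trans (*-congˡ (*-distribˡ-∑ y f)) (*-distribˡ-∑ x _)
    swap : ∀ sᵢ sⱼ x y e → (- sⱼ) * (x * (sᵢ * (y * e))) ≈ (- sᵢ) * (y * (sⱼ * (x * e)))
    swap sᵢ sⱼ x y e = begin
      (- sⱼ) * (x * (sᵢ * (y * e)))  ≈⟨ -‿distribˡ-* sⱼ _ ⟨
      - (sⱼ * (x * (sᵢ * (y * e))))  ≈⟨ -‿cong (solve 5 (λ sᵢ sⱼ x y e →
                                          sⱼ ⊗ (x ⊗ (sᵢ ⊗ (y ⊗ e))) ⊜ sᵢ ⊗ (y ⊗ (sⱼ ⊗ (x ⊗ e))))
                                          ≈-refl sᵢ sⱼ x y e) ⟩
      - (sᵢ * (y * (sⱼ * (x * e))))  ≈⟨ -‿distribˡ-* sᵢ _ ⟩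
      (- sᵢ) * (y * (sⱼ * (x * e)))  ∎

  det-transpose : ∀ n (M : Matrix n) → det n (λ i j → M j i) ≈ det n M
  det-transpose zero    M = ≈-refl
  det-transpose (suc n) M = begin
    ∑[ j < suc n ] (sign (toℕ j) * (M j zero * det n (λ r c → M (punchIn j c) (suc r))))
      ≈⟨ ∑-cong (λ j → *-congˡ (*-congˡ (det-transpose n (columnMinor M j)))) ⟩
    ∑[ j < suc n ] (sign (toℕ j) * (M j zero * det n (columnMinor M j)))
      ≈⟨ det-expand-column n M ⟨
    det (suc n) M
      ∎

  ∏*∏≈1 : ∀ {n} (e : Fin n → Carrier) → (∀ i → e i * e i ≈ 1#) → ∏ e * ∏ e ≈ 1#
  ∏*∏≈1 {n} e e²≈1 = begin
    ∏ e * ∏ e               ≈⟨ Product.∑-distrib-+ e e ⟨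
    ∏ (λ i → e i * e i)     ≈⟨ Product.sum-cong-≋ e²≈1 ⟩
    ∏ {n} (λ _ → 1#)        ≈⟨ Product.sum-replicate-zero n ⟩
    1#                      ∎

  scalarMatrix : ∀ {n} → Carrier → Matrix n
  scalarMatrix x i j = if does (i ≟ j) then x else 0#

  charMatrix : ∀ {n} → Carrier → Matrix n → Matrix n
  charMatrix x B i j = scalarMatrix x i j - B i j

  scalarMatrix-symmetric : ∀ {n} x (i j : Fin n) → scalarMatrix x i j ≡ scalarMatrix x j i
  scalarMatrix-symmetric x i j with i ≟ j | j ≟ i
  ... | yes _    | yes _    = refl
  ... | no  _    | no  _    = refl
  ... | yes refl | no  j≢i  = contradiction refl j≢i
  ... | no  i≢j  | yes refl = contradiction refl i≢j

  det-charMatrix-transpose : ∀ n x (B : Matrix n) →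
    det n (charMatrix x (λ i j → B j i)) ≈ det n (charMatrix x B)
  det-charMatrix-transpose n x B = ≈-trans
    (det-cong n λ i j → ≈-reflexive (cong (_- B j i) (scalarMatrix-symmetric x i j)))
    (det-transpose n (charMatrix x B))

  det-charMatrix-conjugate : ∀ n x (e : Fin n → Carrier) (B B′ : Matrix n) →
    (∀ i → e i * e i ≈ 1#) → (∀ i j → B′ i j ≈ e i * (e j * B i j)) →
    det n (charMatrix x B′) ≈ det n (charMatrix x B)
  det-charMatrix-conjugate n x e B B′ e²≈1 B′≈eBe = begin
    det n (charMatrix x B′)                              ≈⟨ det-cong n conjugate-entry ⟩
    det n (λ i j → e i * (e j * charMatrix x B i j))     ≈⟨ det-scale n e e (charMatrix x B) ⟩
    (∏ e * ∏ e) * det n (charMatrix x B)                 ≈⟨ *-congʳ (∏*∏≈1 e e²≈1) ⟩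
    1# * det n (charMatrix x B)                          ≈⟨ *-identityˡ _ ⟩
    det n (charMatrix x B)                               ∎
    where
    conjugate-scalar : ∀ i j → e i * (e j * scalarMatrix x i j) ≈ scalarMatrix x i j
    conjugate-scalar i j with i ≟ j
    ... | yes refl = ≈-trans (≈-sym (*-assoc (e i) (e i) x)) (≈-trans (*-congʳ (e²≈1 i)) (*-identityˡ x))
    ... | no  _    = ≈-trans (*-congˡ (zeroʳ (e j))) (zeroʳ (e i))
    conjugate-entry : ∀ i j → charMatrix x B′ i j ≈ e i * (e j * charMatrix x B i j)
    conjugate-entry i j = begin
      scalarMatrix x i j - B′ i j                                  ≈⟨ +-congˡ (-‿cong (B′≈eBe i j)) ⟩
      scalarMatrix x i j - e i * (e j * B i j)                     ≈⟨ +-congʳ (conjugate-scalar i j) ⟨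
      e i * (e j * scalarMatrix x i j) - e i * (e j * B i j)       ≈⟨ x[y-z]≈xy-xz (e i) _ _ ⟨
      e i * (e j * scalarMatrix x i j - e j * B i j)               ≈⟨ *-congˡ (x[y-z]≈xy-xz (e j) _ _) ⟨
      e i * (e j * charMatrix x B i j)                             ∎

-- Signed graphs

x⊕[x⊕y]≡y : ∀ x y → x ⊕ (x ⊕ y) ≡ y
x⊕[x⊕y]≡y x y = begin
  x ⊕ (x ⊕ y)  ≡⟨ ℙ.+-assoc x x y ⟨
  (x ⊕ x) ⊕ y  ≡⟨ cong (_⊕ y) (ℙ.p+p≡0ℙ x) ⟩
  y            ∎
  where open ≡-Reasoning

x⊕y≡0ℙ⇒x≡y : ∀ {x y} → x ⊕ y ≡ 0ℙ → x ≡ y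
x⊕y≡0ℙ⇒x≡y {x} {y} x⊕y≡0 = begin
  x            ≡⟨ x⊕[x⊕y]≡y y x ⟨
  y ⊕ (y ⊕ x)  ≡⟨ cong (y ⊕_) (trans (ℙ.+-comm y x) x⊕y≡0) ⟩
  y ⊕ 0ℙ       ≡⟨ ℙ.+-identityʳ y ⟩
  y            ∎
  where open ≡-Reasoning

[z⊕x]⊕[z⊕y]≡x⊕y : ∀ z x y → (z ⊕ x) ⊕ (z ⊕ y) ≡ x ⊕ y
[z⊕x]⊕[z⊕y]≡x⊕y z x y = begin
  (z ⊕ x) ⊕ (z ⊕ y)  ≡⟨ interchange z x z y ⟩
  (z ⊕ z) ⊕ (x ⊕ y)  ≡⟨ cong (_⊕ (x ⊕ y)) (ℙ.p+p≡0ℙ z) ⟩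
  x ⊕ y              ∎
  where open ≡-Reasoning

module SignedGraph
  {n : ℕ} (_~_ : Fin n → Fin n → Set) (_~?_ : Decidable _~_)
  (~-sym : ∀ {u v} → u ~ v → v ~ u) (~-irrefl : ∀ {u} → ¬ u ~ u)
  (σ : Fin n → Fin n → Parity) (σ-sym : ∀ u v → σ v u ≡ σ u v)
  where

  infixr 5 _∷_ _++_

  data Walk : Fin n → Fin n → Set where
    []  : ∀ {u} → Walk u u
    _∷_ : ∀ {u v w} → u ~ v → Walk v w → Walk u w

  private variable u v w x : Fin n

  length : Walk u v → ℕ
  length []      = 0
  length (_ ∷ W) = suc (length W)

  weight : Walk u v → Parity
  weight []                = 0ℙ
  weight (_∷_ {u} {v} _ W) = σ u v ⊕ weight W

  _++_ : Walk u v → Walk v w → Walk u w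
  []      ++ V = V
  (e ∷ W) ++ V = e ∷ (W ++ V)

  weight-++ : (W : Walk u v) (V : Walk v w) → weight (W ++ V) ≡ weight W ⊕ weight V
  weight-++ []                V = refl
  weight-++ (_∷_ {u} {v} e W) V = trans (cong (σ u v ⊕_) (weight-++ W V)) (sym (ℙ.+-assoc (σ u v) (weight W) (weight V)))

  reverse : Walk u v → Walk v u
  reverse []      = []
  reverse (e ∷ W) = reverse W ++ (~-sym e ∷ [])

  weight-reverse : (W : Walk u v) → weight (reverse W) ≡ weight W
  weight-reverse []                = refl
  weight-reverse (_∷_ {u} {v} e W) = begin
    weight (reverse W ++ (~-sym e ∷ []))  ≡⟨ weight-++ (reverse W) (~-sym e ∷ []) ⟩
    weight (reverse W) ⊕ (σ v u ⊕ 0ℙ)     ≡⟨ cong₂ _⊕_ (weight-reverse W)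
                                                      (trans (ℙ.+-identityʳ (σ v u)) (σ-sym u v)) ⟩
    weight W ⊕ σ u v                      ≡⟨ ℙ.+-comm (weight W) (σ u v) ⟩
    σ u v ⊕ weight W                      ∎
    where open ≡-Reasoning

  through : Walk w u → u ~ v → Walk x v → Walk w x
  through Wu e Wv = Wu ++ (e ∷ reverse Wv)

  weight-through : (Wu : Walk w u) (e : u ~ v) (Wv : Walk x v) →
                   weight (through Wu e Wv) ≡ weight Wu ⊕ (σ u v ⊕ weight Wv)
  weight-through {u = u} {v} Wu e Wv =
    trans (weight-++ Wu (e ∷ reverse Wv)) (cong (λ p → weight Wu ⊕ (σ u v ⊕ p)) (weight-reverse Wv))

  weight-subst₂ : ∀ {u′ v′} (p : u ≡ u′) (q : v ≡ v′) (W : Walk u v) → weight (subst₂ Walk p q W) ≡ weight W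
  weight-subst₂ refl refl W = refl

  _∈ʷ_ : Fin n → Walk u v → Set
  _∈ʷ_ x ([] {u})        = x ≡ u
  _∈ʷ_ x (_∷_ {u} _ W)   = x ≡ u ⊎ x ∈ʷ W

  _∈ʷ?_ : ∀ x (W : Walk u v) → Dec (x ∈ʷ W)
  x ∈ʷ? ([] {u})      = x ≟ u
  x ∈ʷ? (_∷_ {u} _ W) with x ≟ u | x ∈ʷ? W
  ... | yes x≡u | _       = yes (inj₁ x≡u)
  ... | no  _   | yes x∈W = yes (inj₂ x∈W)
  ... | no  x≢u | no  x∉W = no λ { (inj₁ x≡u) → x≢u x≡u ; (inj₂ x∈W) → x∉W x∈W }

  IsPath : Walk u v → Set
  IsPath []                = ⊤
  IsPath (_∷_ {u} _ W)     = ¬ u ∈ʷ W × IsPath W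

  ∈-end : (W : Walk u v) → v ∈ʷ W
  ∈-end []      = refl
  ∈-end (_ ∷ W) = inj₂ (∈-end W)

  ∈-start : (W : Walk u v) → u ∈ʷ W
  ∈-start []      = refl
  ∈-start (_ ∷ _) = inj₁ refl

  ∈-++⁺ˡ : (W : Walk u v) (V : Walk v w) → x ∈ʷ W → x ∈ʷ (W ++ V)
  ∈-++⁺ˡ []      V refl     = ∈-start V
  ∈-++⁺ˡ (e ∷ W) V (inj₁ p) = inj₁ p
  ∈-++⁺ˡ (e ∷ W) V (inj₂ p) = inj₂ (∈-++⁺ˡ W V p)

  split : {W : Walk u v} → x ∈ʷ W → ∃₂ λ (A : Walk u x) (B : Walk x v) → A ++ B ≡ W
  split {W = []}    refl        = [] , [] , refl
  split {W = e ∷ W} (inj₁ refl) = [] , e ∷ W , refl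
  split {W = e ∷ W} (inj₂ x∈W)  with split x∈W
  ... | A , B , refl = e ∷ A , B , refl

  IsPath-++ˡ : (A : Walk u v) (B : Walk v w) → IsPath (A ++ B) → IsPath A
  IsPath-++ˡ []      B _              = tt
  IsPath-++ˡ (e ∷ A) B (u∉A++B , p) = (λ u∈A → u∉A++B (∈-++⁺ˡ A B u∈A)) , IsPath-++ˡ A B p

  IsPath-++ʳ : (A : Walk u v) (B : Walk v w) → IsPath (A ++ B) → IsPath B
  IsPath-++ʳ []      B p       = p
  IsPath-++ʳ (e ∷ A) B (_ , p) = IsPath-++ʳ A B p

  vertex : (W : Walk u v) → Fin (suc (length W)) → Fin n
  vertex {u = u} []      zero    = u
  vertex {u = u} (_ ∷ W) zero    = u
  vertex         (_ ∷ W) (suc i) = vertex W i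

  vertex-zero : (W : Walk u v) → vertex W zero ≡ u
  vertex-zero []      = refl
  vertex-zero (_ ∷ W) = refl

  vertex-last : (W : Walk u v) → vertex W (fromℕ (length W)) ≡ v
  vertex-last []      = refl
  vertex-last (_ ∷ W) = vertex-last W

  vertex-∈ : (W : Walk u v) (i : Fin (suc (length W))) → vertex W i ∈ʷ W
  vertex-∈ []      zero    = refl
  vertex-∈ (_ ∷ W) zero    = inj₁ refl
  vertex-∈ (_ ∷ W) (suc i) = inj₂ (vertex-∈ W i)

  vertex-injective : (W : Walk u v) → IsPath W → ∀ i j → vertex W i ≡ vertex W j → i ≡ j
  vertex-injective []      _           zero    zero    _  = refl
  vertex-injective (_ ∷ W) _           zero    zero    _  = refl
  vertex-injective (_ ∷ W) (u∉W , _)   zero    (suc j) eq = contradiction (subst (_∈ʷ W) (sym eq) (vertex-∈ W j)) u∉W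
  vertex-injective (_ ∷ W) (u∉W , _)   (suc i) zero    eq = contradiction (subst (_∈ʷ W) eq (vertex-∈ W i)) u∉W
  vertex-injective (_ ∷ W) (_ , isPath) (suc i) (suc j) eq = cong suc (vertex-injective W isPath i j eq)

  vertex-adjacent : (W : Walk u v) (i : Fin (length W)) → vertex W (inject₁ i) ~ vertex W (suc i)
  vertex-adjacent (e ∷ W) zero    = subst (_ ~_) (sym (vertex-zero W)) e
  vertex-adjacent (e ∷ W) (suc i) = vertex-adjacent W i

  -- σ u v ⊕ weight P is the weight of the cycle formed by the edge u ~ v and the path P.
  CyclesBalanced : Set
  CyclesBalanced = ∀ {u v} (e : u ~ v) (P : Walk v u) → IsPath P → 2 ≤ length P → σ u v ⊕ weight P ≡ 0ℙ

  -- Union–find: a vertex records the root of its class and the weight of a walk from that root.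
  -- Merging the classes along every edge leaves all edges consistent, so the offsets form a
  -- switching function.
  Labelling : Set
  Labelling = Fin n → Fin n × Parity

  root : Labelling → Fin n → Fin n
  root L x = proj₁ (L x)

  offset : Labelling → Fin n → Parity
  offset L x = proj₂ (L x)

  Sound : Labelling → Set
  Sound L = ∀ x → Σ[ W ∈ Walk (root L x) x ] weight W ≡ offset L x

  Consistent : Labelling → Fin n × Fin n → Set
  Consistent L (u , v) = u ~ v → root L u ≡ root L v × offset L u ⊕ offset L v ≡ σ u v

  merge : Fin n → Fin n → Labelling → Labelling
  merge u v L x with root L u ≟ root L v | root L x ≟ root L v
  ... | yes _ | _     = L x
  ... | no  _ | yes _ = root L u , (offset L u ⊕ (σ u v ⊕ offset L v)) ⊕ offset L x
  ... | no  _ | no  _ = L x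

  merge-sound : u ~ v → ∀ L → Sound L → Sound (merge u v L)
  merge-sound {u} {v} e L sound x with root L u ≟ root L v | root L x ≟ root L v
  ... | yes _ | _     = sound x
  ... | no  _ | no  _ = sound x
  ... | no  _ | yes rx≡rv with sound u | sound v | sound x
  ...   | Wu , wu | Wv , wv | Wx , wx =
    through Wu e Wv ++ subst₂ Walk rx≡rv refl Wx , (begin
      weight (through Wu e Wv ++ subst₂ Walk rx≡rv refl Wx)
        ≡⟨ weight-++ (through Wu e Wv) _ ⟩
      weight (through Wu e Wv) ⊕ weight (subst₂ Walk rx≡rv refl Wx)
        ≡⟨ cong₂ _⊕_ (weight-through Wu e Wv) (weight-subst₂ rx≡rv refl Wx) ⟩
      (weight Wu ⊕ (σ u v ⊕ weight Wv)) ⊕ weight Wx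
        ≡⟨ cong₂ (λ a b → (a ⊕ (σ u v ⊕ b)) ⊕ weight Wx) wu wv ⟩
      (offset L u ⊕ (σ u v ⊕ offset L v)) ⊕ weight Wx
        ≡⟨ cong ((offset L u ⊕ (σ u v ⊕ offset L v)) ⊕_) wx ⟩
      (offset L u ⊕ (σ u v ⊕ offset L v)) ⊕ offset L x ∎)
    where open ≡-Reasoning

  ClosedWalksBalanced : Set
  ClosedWalksBalanced = ∀ {u} (W : Walk u u) → weight W ≡ 0ℙ

  merge-consistent : ClosedWalksBalanced → u ~ v → ∀ L → Sound L → Consistent (merge u v L) (u , v)
  merge-consistent {u} {v} balanced e L sound _ with root L u ≟ root L v
  ... | yes ru≡rv with sound u | sound v
  ...   | Wu , wu | Wv , wv = ru≡rv , x⊕y≡0ℙ⇒x≡y (begin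
    (offset L u ⊕ offset L v) ⊕ σ u v   ≡⟨ ℙ.+-assoc (offset L u) (offset L v) (σ u v) ⟩
    offset L u ⊕ (offset L v ⊕ σ u v)   ≡⟨ cong (offset L u ⊕_) (ℙ.+-comm (offset L v) (σ u v)) ⟩
    offset L u ⊕ (σ u v ⊕ offset L v)   ≡⟨ cong₂ (λ a b → a ⊕ (σ u v ⊕ b)) wu wv ⟨
    weight Wu ⊕ (σ u v ⊕ weight Wv)     ≡⟨ weight-through Wu e Wv ⟨
    weight (through Wu e Wv)            ≡⟨ weight-subst₂ refl (sym ru≡rv) (through Wu e Wv) ⟨
    weight closed                       ≡⟨ balanced closed ⟩
    0ℙ                                  ∎)
    where
    open ≡-Reasoning
    closed : Walk (root L u) (root L u)
    closed = subst₂ Walk refl (sym ru≡rv) (through Wu e Wv)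
  merge-consistent {u} {v} balanced e L sound _ | no _ with root L v ≟ root L v
  ... | no rv≢rv = contradiction refl rv≢rv
  ... | yes _    = refl , (begin
    a ⊕ ((a ⊕ (s ⊕ b)) ⊕ b)   ≡⟨ cong (a ⊕_) (ℙ.+-assoc a (s ⊕ b) b) ⟩
    a ⊕ (a ⊕ ((s ⊕ b) ⊕ b))   ≡⟨ x⊕[x⊕y]≡y a ((s ⊕ b) ⊕ b) ⟩
    (s ⊕ b) ⊕ b               ≡⟨ ℙ.+-assoc s b b ⟩
    s ⊕ (b ⊕ b)               ≡⟨ cong (s ⊕_) (ℙ.p+p≡0ℙ b) ⟩
    s ⊕ 0ℙ                    ≡⟨ ℙ.+-identityʳ s ⟩
    s                         ∎)
    where
    open ≡-Reasoning
    a = offset L u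
    b = offset L v
    s = σ u v

  merge-preserves : ∀ L {e′} → Consistent L e′ → Consistent (merge u v L) e′
  merge-preserves {u} {v} L {x , y} consistent x~y
    with root L u ≟ root L v | root L x ≟ root L v | root L y ≟ root L v
  ... | yes _ | _        | _        = consistent x~y
  ... | no  _ | no  _    | no  _    = consistent x~y
  ... | no  _ | yes _    | yes _    = refl ,
    trans ([z⊕x]⊕[z⊕y]≡x⊕y (offset L u ⊕ (σ u v ⊕ offset L v)) (offset L x) (offset L y)) (proj₂ (consistent x~y))
  ... | no  _ | yes rx≡rv | no ry≢rv = contradiction (trans (sym (proj₁ (consistent x~y))) rx≡rv) ry≢rv
  ... | no  _ | no rx≢rv  | yes ry≡rv = contradiction (trans (proj₁ (consistent x~y)) ry≡rv) rx≢rv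

  process : Fin n × Fin n → Labelling → Labelling
  process (u , v) L with u ~? v
  ... | yes _ = merge u v L
  ... | no  _ = L

  process-sound : ∀ e L → Sound L → Sound (process e L)
  process-sound (u , v) L sound with u ~? v
  ... | yes u~v = merge-sound u~v L sound
  ... | no  _   = sound

  process-preserves : ∀ e L {e′} → Consistent L e′ → Consistent (process e L) e′
  process-preserves (u , v) L consistent with u ~? v
  ... | yes _ = merge-preserves L consistent
  ... | no  _ = consistent

  process-consistent : ClosedWalksBalanced → ∀ e L → Sound L → Consistent (process e L) e
  process-consistent balanced (u , v) L sound with u ~? v
  ... | yes u~v = merge-consistent balanced u~v L sound
  ... | no  u≁v = λ u~v → contradiction u~v u≁v

  processAll : List (Fin n × Fin n) → Labelling → Labelling
  processAll []       L = L
  processAll (e ∷ es) L = processAll es (process e L)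

  processAll-sound : ∀ es L → Sound L → Sound (processAll es L)
  processAll-sound []       L sound = sound
  processAll-sound (e ∷ es) L sound = processAll-sound es (process e L) (process-sound e L sound)

  processAll-preserves : ∀ es L {e′} → Consistent L e′ → Consistent (processAll es L) e′
  processAll-preserves []       L c = c
  processAll-preserves (e ∷ es) L c = processAll-preserves es (process e L) (process-preserves e L c)

  processAll-consistent : ClosedWalksBalanced → ∀ es L → Sound L → All (Consistent (processAll es L)) es
  processAll-consistent balanced []       L sound = []
  processAll-consistent balanced (e ∷ es) L sound =
    processAll-preserves es (process e L) (process-consistent balanced e L sound) ∷
    processAll-consistent balanced es (process e L) (process-sound e L sound)

  closedWalksBalanced⇒switching : ClosedWalksBalanced →
    Σ[ s ∈ (Fin n → Parity) ] (∀ {u v} → u ~ v → s u ⊕ s v ≡ σ u v)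
  closedWalksBalanced⇒switching balanced = offset final , λ {u} {v} u~v →
    proj₂ (All.lookup (processAll-consistent balanced pairs singletons (λ x → [] , refl))
                      (∈-cartesianProduct⁺ (∈-allFin u) (∈-allFin v)) u~v)
    where
    pairs = cartesianProduct (allFin n) (allFin n)
    singletons : Labelling
    singletons x = x , 0ℙ
    final = processAll pairs singletons

  module _ (cycles-balanced : CyclesBalanced) where

    closing-balanced : (e : u ~ v) (P : Walk v u) → IsPath P → σ u v ⊕ weight P ≡ 0ℙ
    closing-balanced e []                  _      = contradiction e ~-irrefl
    closing-balanced {u} {v} e (_ ∷ [])    _      =
      trans (cong (σ u v ⊕_) (trans (ℙ.+-identityʳ (σ v u)) (σ-sym u v))) (ℙ.p+p≡0ℙ (σ u v))
    closing-balanced e P@(_ ∷ _ ∷ _) isPath = cycles-balanced e P isPath (s≤s (s≤s z≤n))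

    shortcut : (W : Walk u v) → Σ[ P ∈ Walk u v ] IsPath P × weight P ≡ weight W
    shortcut [] = [] , tt , refl
    shortcut (_∷_ {u} {v} e W) with shortcut W
    ... | P , isPath , wP≡wW with u ∈ʷ? P
    ...   | no  u∉P = e ∷ P , (u∉P , isPath) , cong (σ u v ⊕_) wP≡wW
    ...   | yes u∈P with split u∈P
    ...     | A , B , refl = B , IsPath-++ʳ A B isPath , (begin
      weight B                           ≡⟨ cong (_⊕ weight B) (closing-balanced e A (IsPath-++ˡ A B isPath)) ⟨
      (σ u v ⊕ weight A) ⊕ weight B      ≡⟨ ℙ.+-assoc (σ u v) (weight A) (weight B) ⟩
      σ u v ⊕ (weight A ⊕ weight B)      ≡⟨ cong (σ u v ⊕_) (weight-++ A B) ⟨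
      σ u v ⊕ weight (A ++ B)            ≡⟨ cong (σ u v ⊕_) wP≡wW ⟩
      σ u v ⊕ weight W                   ∎)
      where open ≡-Reasoning

    cyclesBalanced⇒closedWalksBalanced : ClosedWalksBalanced
    cyclesBalanced⇒closedWalksBalanced W with shortcut W
    ... | []    , _         , w≡ = sym w≡
    ... | _ ∷ P , (u∉P , _) , _  = contradiction (∈-end P) u∉P

-- Mixed graphs

2∣⇒parity≡0ℙ : ∀ {k} → 2 ∣ k → parity k ≡ 0ℙ
2∣⇒parity≡0ℙ (divides q refl) = trans (ℙ.*-homo-* q 2) (ℙ.*-zeroʳ (parity q))

parity≡0ℙ⇒2∣ : ∀ k → parity k ≡ 0ℙ → 2 ∣ k
parity≡0ℙ⇒2∣ zero          _  = 2 ∣0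
parity≡0ℙ⇒2∣ (suc zero)    ()
parity≡0ℙ⇒2∣ (suc (suc k)) eq = ∣m∣n⇒∣m+n ∣-refl (parity≡0ℙ⇒2∣ k eq)

parity-agree : ∀ {a b} → (2 ∣ a → 2 ∣ b) → (¬ 2 ∣ a → ¬ 2 ∣ b) → parity a ≡ parity b
parity-agree {a} {b} even⇒even odd⇒odd with parity a in pa | parity b in pb
... | 0ℙ | 0ℙ = refl
... | 1ℙ | 1ℙ = refl
... | 0ℙ | 1ℙ = contradiction (trans (sym pb) (2∣⇒parity≡0ℙ (even⇒even (parity≡0ℙ⇒2∣ a pa)))) λ ()
... | 1ℙ | 0ℙ = contradiction (parity≡0ℙ⇒2∣ b pb)
                  (odd⇒odd λ 2∣a → contradiction (trans (sym pa) (2∣⇒parity≡0ℙ 2∣a)) λ ())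

arcParity : Link → Parity
arcParity none  = 0ℙ
arcParity digon = 0ℙ
arcParity out   = 1ℙ
arcParity inn   = 1ℙ

arcParity-rev : ∀ l → arcParity (rev l) ≡ arcParity l
arcParity-rev none  = refl
arcParity-rev digon = refl
arcParity-rev out   = refl
arcParity-rev inn   = refl

rev≡none⇒≡none : ∀ {l} → rev l ≡ none → l ≡ none
rev≡none⇒≡none {none} _ = refl

_≟none : (l : Link) → Dec (l ≡ none)
none  ≟none = yes refl
digon ≟none = no λ ()
out   ≟none = no λ ()
inn   ≟none = no λ ()

parity-isDigon : ∀ l → l ≢ none → parity (isDigon l) ≡ 1ℙ ⊕ arcParity l
parity-isDigon none  l≢none = contradiction refl l≢none
parity-isDigon digon _      = refl
parity-isDigon out   _      = refl
parity-isDigon inn   _      = refl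

module _ {n : ℕ} (D : MixedGraph n) where

  Adjacent : Fin n → Fin n → Set
  Adjacent u v = adj D u v ≢ none

  private
    adjacent-sym : ∀ {u v} → Adjacent u v → Adjacent v u
    adjacent-sym {u} {v} u~v v~u≡none = u~v (rev≡none⇒≡none (trans (sym (adj-rev D u v)) v~u≡none))

    arcParity-sym : ∀ u v → arcParity (adj D v u) ≡ arcParity (adj D u v)
    arcParity-sym u v = trans (cong arcParity (adj-rev D u v)) (arcParity-rev (adj D u v))

    open SignedGraph Adjacent (λ u v → ¬? (adj D u v ≟none)) adjacent-sym
      (λ {u} u~u → u~u (loopless D u)) (λ u v → arcParity (adj D u v)) arcParity-sym

    digons : ∀ {u v} → Walk u v → ℕ
    digons []                = 0
    digons (_∷_ {u} {v} _ W) = isDigon (adj D u v) ℕ.+ digons W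

    parity-digons : ∀ {u v} (W : Walk u v) → parity (digons W) ≡ parity (length W) ⊕ weight W
    parity-digons []                   = refl
    parity-digons (_∷_ {u} {v} u~v W) = begin
      parity (isDigon l ℕ.+ digons W)            ≡⟨ ℙ.+-homo-+ (isDigon l) (digons W) ⟩
      parity (isDigon l) ⊕ parity (digons W)     ≡⟨ cong₂ _⊕_ (parity-isDigon l u~v) (parity-digons W) ⟩
      (1ℙ ⊕ a) ⊕ (parity (length W) ⊕ weight W)  ≡⟨ interchange 1ℙ a (parity (length W)) (weight W) ⟩
      (1ℙ ⊕ parity (length W)) ⊕ (a ⊕ weight W)  ≡⟨ cong (_⊕ (a ⊕ weight W)) (ℙ.+-homo-+ 1 (length W)) ⟨
      parity (suc (length W)) ⊕ (a ⊕ weight W)   ∎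
      where
      open ≡-Reasoning
      l = adj D u v
      a = arcParity l

    sum-digons : ∀ {u v} (W : Walk u v) →
      ListAction.sum (tabulate (λ i → isDigon (adj D (vertex W (inject₁ i)) (vertex W (suc i))))) ≡ digons W
    sum-digons []                = refl
    sum-digons (_∷_ {u} u~v W) = cong₂ ℕ._+_ (cong (λ x → isDigon (adj D u x)) (vertex-zero W)) (sum-digons W)

    toCycle : ∀ {u v} → Adjacent u v → (P : Walk v u) → IsPath P → 2 ≤ length P → Cycle D
    toCycle u~v P isPath long = record
      { m = length P ; long = long ; vert = vertex P
      ; injective = vertex-injective P isPath ; step-adj = vertex-adjacent P
      ; close-adj = subst₂ Adjacent (sym (vertex-last P)) (sym (vertex-zero P)) u~v }

    digonCount-toCycle : ∀ {u v} (u~v : Adjacent u v) (P : Walk v u) isPath long →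
      digonCount (toCycle u~v P isPath long) ≡ digons P ℕ.+ isDigon (adj D u v)
    digonCount-toCycle u~v P _ _ = cong₂ ℕ._+_
      (trans (cong ListAction.sum (map-tabulate id λ i → isDigon (adj D (vertex P (inject₁ i)) (vertex P (suc i)))))
             (sum-digons P))
      (cong₂ (λ x y → isDigon (adj D x y)) (vertex-last P) (vertex-zero P))

  switching : (∀ (C : Cycle D) →
                 (2 ∣ cycleLength C → 2 ∣ digonCount C) × (¬ (2 ∣ cycleLength C) → ¬ (2 ∣ digonCount C))) →
              Σ[ s ∈ (Fin n → Parity) ] (∀ {u v} → Adjacent u v → s u ⊕ s v ≡ arcParity (adj D u v))
  switching hyp = closedWalksBalanced⇒switching (cyclesBalanced⇒closedWalksBalanced cyclesBalanced)
    where
    cyclesBalanced : CyclesBalanced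
    cyclesBalanced {u} {v} u~v P isPath long = ℙ.+-cancelˡ-≡ (1ℙ ⊕ L) _ _ (begin
      (1ℙ ⊕ L) ⊕ (a ⊕ w)                                ≡⟨ interchange 1ℙ L a w ⟩
      (1ℙ ⊕ a) ⊕ (L ⊕ w)                                ≡⟨ ℙ.+-comm (1ℙ ⊕ a) (L ⊕ w) ⟩
      (L ⊕ w) ⊕ (1ℙ ⊕ a)                                ≡⟨ cong₂ _⊕_ (parity-digons P) (parity-isDigon (adj D u v) u~v) ⟨
      parity (digons P) ⊕ parity (isDigon (adj D u v))  ≡⟨ ℙ.+-homo-+ (digons P) (isDigon (adj D u v)) ⟨
      parity (digons P ℕ.+ isDigon (adj D u v))         ≡⟨ cong parity (digonCount-toCycle u~v P isPath long) ⟨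
      parity (digonCount C)                             ≡⟨ agree ⟨
      parity (suc (length P))                           ≡⟨ ℙ.+-homo-+ 1 (length P) ⟩
      1ℙ ⊕ L                                            ≡⟨ ℙ.+-identityʳ (1ℙ ⊕ L) ⟨
      (1ℙ ⊕ L) ⊕ 0ℙ                                     ∎)
      where
      open ≡-Reasoning
      C = toCycle u~v P isPath long
      L = parity (length P)
      a = arcParity (adj D u v)
      w = weight P
      agree : parity (cycleLength C) ≡ parity (digonCount C)
      agree = parity-agree (proj₁ (hyp C)) (proj₂ (hyp C))

-- Characteristic polynomials of Hermitian adjacency matrices

private module PolyDet = Determinant Poly-commutativeRing

ε : Parity → Eis
ε 0ℙ = 1E
ε 1ℙ = -E 1E

ε-homo : ∀ p q → ε (p ⊕ q) ≡ ε p *E ε q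
ε-homo 0ℙ 0ℙ = refl
ε-homo 0ℙ 1ℙ = refl
ε-homo 1ℙ 0ℙ = refl
ε-homo 1ℙ 1ℙ = refl

hEntry-rev : ∀ α l → hEntry α (rev l) ≡ hEntry (conjE α) l
hEntry-rev α none  = refl
hEntry-rev α digon = refl
hEntry-rev α out   = refl
hEntry-rev α inn   = sym (conjE-involutive α)

hEntry-negate : ∀ α l → hEntry (-E α) l ≡ ε (arcParity l) *E hEntry α l
hEntry-negate α none  = refl
hEntry-negate α digon = refl
hEntry-negate α out   = sym (-1*x≈-x α)
hEntry-negate α inn   = trans (conjE-neg α) (sym (-1*x≈-x (conjE α)))

hEntry-switch : ∀ α l p q → (l ≢ none → p ⊕ q ≡ arcParity l) → hEntry (-E α) l ≡ ε p *E (ε q *E hEntry α l)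
hEntry-switch α l p q switched with l ≟none
... | yes refl = sym (trans (cong (ε p *E_) (E.zeroʳ (ε q))) (E.zeroʳ (ε p)))
... | no l≢none = begin
  hEntry (-E α) l               ≡⟨ hEntry-negate α l ⟩
  ε (arcParity l) *E hEntry α l ≡⟨ cong (λ x → ε x *E hEntry α l) (switched l≢none) ⟨
  ε (p ⊕ q) *E hEntry α l       ≡⟨ cong (_*E hEntry α l) (ε-homo p q) ⟩
  (ε p *E ε q) *E hEntry α l    ≡⟨ E.*-assoc (ε p) (ε q) (hEntry α l) ⟩
  ε p *E (ε q *E hEntry α l)    ∎
  where open ≡-Reasoning

constP-*E : ∀ a b → constP (a *E b) ≋ constP a *P constP b
constP-*E a b = ∷-cong (sym (E.+-identityʳ (a *E b))) ≋-refl

signP≡sign : ∀ k → signP k ≡ PolyDet.sign k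
signP≡sign zero    = refl
signP≡sign (suc k) = cong (scaleP (-E 1E)) (signP≡sign k)

det≡det : ∀ n M → Defs.det n M ≡ PolyDet.det n M
det≡det zero    M = refl
det≡det (suc n) M = trans
  (cong sumP (map-cong (λ j → cong₂ _*P_ (signP≡sign (toℕ j)) (cong (M zero j *P_) (det≡det n _))) (allFin (suc n))))
  (PolyDet.foldr-map-allFin _)

charDet : ∀ n → (Fin n → Fin n → Eis) → Poly
charDet n A = PolyDet.det n (PolyDet.charMatrix xP (λ i j → constP (A i j)))

charPoly≋charDet : ∀ n A → charPoly n A ≋ charDet n A
charPoly≋charDet n A = ≋-trans (≋-reflexive (det≡det n _)) (PolyDet.det-cong n λ i j →
  +P-congˡ (PolyDet.scalarMatrix xP i j) (∷-cong (sym (-1*x≈-x (A i j))) ≋-refl))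

charDet-cong : ∀ n {A B : Fin n → Fin n → Eis} → (∀ i j → A i j ≡ B i j) → charDet n A ≋ charDet n B
charDet-cong n A≡B = PolyDet.det-cong n λ i j →
  ≋-reflexive (cong (λ a → PolyDet.charMatrix xP (λ _ _ → constP a) i j) (A≡B i j))

charPoly-conjE : ∀ {n} (D : MixedGraph n) α → charPoly n (Hα α D) ≋ charPoly n (Hα (conjE α) D)
charPoly-conjE {n} D α = begin
  charPoly n (Hα α D)                  ≈⟨ charPoly≋charDet n (Hα α D) ⟩
  charDet n (Hα α D)                   ≈⟨ PolyDet.det-charMatrix-transpose n xP (λ i j → constP (Hα α D i j)) ⟨
  charDet n (λ i j → Hα α D j i)       ≈⟨ charDet-cong n Hα-transpose ⟩
  charDet n (Hα (conjE α) D)           ≈⟨ charPoly≋charDet n (Hα (conjE α) D) ⟨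
  charPoly n (Hα (conjE α) D)          ∎
  where
  open import Relation.Binary.Reasoning.Setoid ≋-setoid
  Hα-transpose : ∀ i j → Hα α D j i ≡ Hα (conjE α) D i j
  Hα-transpose i j = trans (cong (hEntry α) (adj-rev D i j)) (hEntry-rev α (adj D i j))

charPoly-negate : ∀ {n} (D : MixedGraph n) α (s : Fin n → Parity) →
  (∀ {u v} → Adjacent D u v → s u ⊕ s v ≡ arcParity (adj D u v)) →
  charPoly n (Hα (-E α) D) ≋ charPoly n (Hα α D)
charPoly-negate {n} D α s switched = begin
  charPoly n (Hα (-E α) D)  ≈⟨ charPoly≋charDet n (Hα (-E α) D) ⟩
  charDet n (Hα (-E α) D)   ≈⟨ PolyDet.det-charMatrix-conjugate n xP e
                                 (λ i j → constP (Hα α D i j)) (λ i j → constP (Hα (-E α) D i j)) e²≈1 conjugated ⟩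
  charDet n (Hα α D)        ≈⟨ charPoly≋charDet n (Hα α D) ⟨
  charPoly n (Hα α D)       ∎
  where
  open import Relation.Binary.Reasoning.Setoid ≋-setoid
  e : Fin n → Poly
  e i = constP (ε (s i))
  e²≈1 : ∀ i → e i *P e i ≋ constP 1E
  e²≈1 i = ≋-trans (≋-sym (constP-*E (ε (s i)) (ε (s i))))
                   (∷-cong (trans (sym (ε-homo (s i) (s i))) (cong ε (ℙ.p+p≡0ℙ (s i)))) ≋-refl)
  conjugated : ∀ i j → constP (Hα (-E α) D i j) ≋ e i *P (e j *P constP (Hα α D i j))
  conjugated i j = begin
    constP (Hα (-E α) D i j)                      ≡⟨ cong constP (hEntry-switch α (adj D i j) (s i) (s j) switched) ⟩
    constP (ε (s i) *E (ε (s j) *E Hα α D i j))   ≈⟨ constP-*E (ε (s i)) _ ⟩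
    e i *P constP (ε (s j) *E Hα α D i j)         ≈⟨ *P-congʳ (e i) (constP-*E (ε (s j)) _) ⟩
    e i *P (e j *P constP (Hα α D i j))           ∎

theorem4p11 : (n : ℕ) (D : MixedGraph n) →
    (∀ (C : Cycle D) →
      (2 ∣ cycleLength C → 2 ∣ digonCount C) ×
      (¬ (2 ∣ cycleLength C) → ¬ (2 ∣ digonCount C))) →
    SameSpectrum D γE ωE
-- conjE γE and -E ωE are the same Eisenstein integer (conj γ = -ω), so the two steps compose.
theorem4p11 n D hyp with switching D hyp
... | s , switched = coeff-≡ (≋-trans (charPoly-conjE D γE) (charPoly-negate D ωE s switched))
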